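{- Let $G$ be a finite simple graph that contains a cycle of odd length as a subgraph. Then $S(G)$ contains a subdivision of $K_{3,3}$ as a subgraph.
   Context: For a graph $G$, the great shadow $S(G)$ is obtained from $G$ by introducing, for each vertex $v$, a new vertex $v'$ (the shadow vertex of $v$) adjacent to $v$ and to every neighbor of $v$ in $G$; $S(G)$ contains all edges of $G$ and no edges between shadow vertices. A subdivision of a graph $H$ is a graph obtained from $H$ by replacing edges with internally vertex-disjoint paths. -}

module Defs where

open import Data.Nat using (ℕ; zero; suc; _≤_; _%_)
open import Data.Fin using (Fin; zero; suc; inject₁; fromℕ; _≟_)
open import Data.Bool using (Bool; true; false; _∨_)
open import Data.Sum using (_⊎_; inj₁; inj₂; [_,_])
open import Data.Product using (_×_)
open import Relation.Nullary using (¬_; yes; no)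
open import Relation.Nullary.Decidable using (⌊_⌋)
open import Relation.Binary.PropositionalEquality using (_≡_; _≢_; refl; sym; cong₂)
open import Function.Definitions using (Injective)

record Graph (V : Set) : Set where
  field
    adj    : V → V → Bool
    adj-sym : ∀ u v → adj u v ≡ adj v u
    adj-irrefl : ∀ v → adj v v ≡ false

open Graph public

Adj : {V : Set} → Graph V → V → V → Set
Adj G u v = adj G u v ≡ true

FinGraph : ℕ → Set
FinGraph n = Graph (Fin n)

eqF : {n : ℕ} → Fin n → Fin n → Bool
eqF u v = ⌊ u ≟ v ⌋

eqF-sym : {n : ℕ} (u v : Fin n) → eqF u v ≡ eqF v u
eqF-sym u v with u ≟ v | v ≟ u
... | yes _ | yes _ = refl
... | no _  | no _  = refl
... | yes p | no q  with q (sym p)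
... | ()
eqF-sym u v | no q | yes p with q (sym p)
... | ()

-- Great shadow S(G): vertices inj₁ v (original) and inj₂ v (shadow v').
-- v' is adjacent to v and to every neighbour of v; no shadow–shadow edges.
shadowAdj : {n : ℕ} → FinGraph n → Fin n ⊎ Fin n → Fin n ⊎ Fin n → Bool
shadowAdj G (inj₁ u) (inj₁ v) = adj G u v
shadowAdj G (inj₁ u) (inj₂ v) = eqF u v ∨ adj G u v
shadowAdj G (inj₂ u) (inj₁ v) = eqF u v ∨ adj G u v
shadowAdj G (inj₂ u) (inj₂ v) = false

shadowAdj-sym : {n : ℕ} (G : FinGraph n) (u v : Fin n ⊎ Fin n) →
                shadowAdj G u v ≡ shadowAdj G v u
shadowAdj-sym G (inj₁ u) (inj₁ v) = adj-sym G u v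
shadowAdj-sym G (inj₁ u) (inj₂ v) = cong₂ _∨_ (eqF-sym u v) (adj-sym G u v)
shadowAdj-sym G (inj₂ u) (inj₁ v) = cong₂ _∨_ (eqF-sym u v) (adj-sym G u v)
shadowAdj-sym G (inj₂ u) (inj₂ v) = refl

shadowAdj-irrefl : {n : ℕ} (G : FinGraph n) (v : Fin n ⊎ Fin n) →
                   shadowAdj G v v ≡ false
shadowAdj-irrefl G (inj₁ v) = adj-irrefl G v
shadowAdj-irrefl G (inj₂ v) = refl

GreatShadow : {n : ℕ} → FinGraph n → Graph (Fin n ⊎ Fin n)
GreatShadow G = record
  { adj = shadowAdj G
  ; adj-sym = shadowAdj-sym G
  ; adj-irrefl = shadowAdj-irrefl G }

record OddCycle {V : Set} (G : Graph V) : Set where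
  field
    m      : ℕ
    vert   : Fin (suc m) → V
    inj    : Injective _≡_ _≡_ vert
    long   : 3 ≤ suc m
    odd    : suc m % 2 ≡ 1
    step   : ∀ (i : Fin m) → Adj G (vert (inject₁ i)) (vert (suc i))
    close  : Adj G (vert (fromℕ m)) (vert zero)

record Path {V : Set} (G : Graph V) : Set where
  field
    len  : ℕ
    vert : Fin (suc len) → V
    inj  : Injective _≡_ _≡_ vert
    step : ∀ (i : Fin len) → Adj G (vert (inject₁ i)) (vert (suc i))

  first : V
  first = vert zero

  last : V
  last = vert (fromℕ len)

  Interior : Fin (suc len) → Set
  Interior x = x ≢ zero × x ≢ fromℕ len

open Path public using (len; vert; first; last; Interior)

record K33Subdivision {V : Set} (H : Graph V) : Set where
  field
    a b        : Fin 3 → V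
    branch-inj : Injective _≡_ _≡_ [ a , b ]
    path       : Fin 3 → Fin 3 → Path H
    starts     : ∀ i j → first (path i j) ≡ a i
    ends       : ∀ i j → last (path i j) ≡ b j
    interior-avoids-branch :
      ∀ i j (x : Fin (suc (len (path i j)))) → Interior (path i j) x →
      ∀ (w : Fin 3 ⊎ Fin 3) → vert (path i j) x ≢ [ a , b ] w
    internally-disjoint :
      ∀ i j i' j' → ¬ (i ≡ i' × j ≡ j') →
      ∀ (x : Fin (suc (len (path i j)))) → Interior (path i j) x →
      ∀ (y : Fin (suc (len (path i' j')))) →
      vert (path i j) x ≢ vert (path i' j') y

-- Let v₀ … vₘ be an odd cycle of G. In S(G) take the original copies of v₁, v₀, vₘ as
-- one side of K₃,₃ and their shadow copies as the other. Seven of the nine connections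
-- are single edges of S(G): the rungs v v' and the edges given by v₀v₁ and vₘv₀. The
-- remaining two run along the arc v₁ v₂ … vₘ, each switching between original and shadow
-- copies at every step; the two rails start on opposite copies of v₁, so they never meet,
-- and since the arc has an odd number m - 1 of edges each rail ends on the copy of vₘ
-- opposite to the one it started on.
module Submission where

open import Defs
open import Data.Nat using (ℕ; zero; suc; _+_; _%_; s≤s)
open import Data.Fin using (Fin; zero; suc; toℕ; inject₁; fromℕ; opposite; _≟_)
open import Data.Fin.Properties using (suc-injective; toℕ-fromℕ; toℕ-inject₁; opposite-involutive)
open import Data.Bool using (Bool; true; false; not; _∨_)
open import Data.Bool.Properties using (∨-zeroʳ; not-¬; not-involutive)
open import Data.Sum using (_⊎_; inj₁; inj₂; [_,_])
open import Data.Sum.Properties using (inj₁-injective; inj₂-injective)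
open import Data.Product using (_×_; _,_; proj₂)
open import Data.Empty using (⊥-elim)
open import Relation.Nullary using (¬_)
open import Relation.Nullary.Decidable using (⌊_⌋)
open import Relation.Binary.PropositionalEquality using (_≡_; _≢_; refl; sym; trans; cong; subst; ≡-≟-identity)
open import Function using (_∘_)
open import Function.Definitions using (Injective)

opposite-inject₁ : ∀ {n} (i : Fin n) → opposite (inject₁ i) ≡ suc (opposite i)
opposite-inject₁ zero    = refl
opposite-inject₁ (suc i) = cong inject₁ (opposite-inject₁ i)

opposite-injective : ∀ {n} → Injective _≡_ _≡_ (opposite {n})
opposite-injective {x = x} {y} e =
  trans (sym (opposite-involutive x)) (trans (cong opposite e) (opposite-involutive y))

opposite-fromℕ : ∀ n → opposite (fromℕ n) ≡ zero
opposite-fromℕ n = opposite-involutive zero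

alternate : Bool → ℕ → Bool
alternate s zero    = s
alternate s (suc k) = not (alternate s k)

alternate-not : ∀ s k → alternate (not s) k ≡ not (alternate s k)
alternate-not s zero    = refl
alternate-not s (suc k) = cong not (alternate-not s k)

alternate-odd : ∀ s k → k % 2 ≡ 1 → alternate s k ≡ not s
alternate-odd s (suc zero)    _   = refl
alternate-odd s (suc (suc k)) odd = trans (not-involutive (alternate s k)) (alternate-odd s k odd)

module _ {V : Set} (H : Graph V) where

  Adj-sym : ∀ {u v} → Adj H u v → Adj H v u
  Adj-sym {u} {v} e = trans (adj-sym H v u) e

  Adj⇒≢ : ∀ {u v} → Adj H u v → u ≢ v
  Adj⇒≢ {u} e refl with trans (sym e) (adj-irrefl H u)
  ... | ()

  edgePath : ∀ {u v} → Adj H u v → Path H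
  edgePath {u} {v} e = record
    { len = 1 ; vert = endpoint ; inj = endpoint-injective ; step = λ { zero → e } }
    where
    endpoint : Fin 2 → V
    endpoint zero       = u
    endpoint (suc zero) = v

    endpoint-injective : Injective _≡_ _≡_ endpoint
    endpoint-injective {zero}     {zero}     _  = refl
    endpoint-injective {zero}     {suc zero} eq = ⊥-elim (Adj⇒≢ e eq)
    endpoint-injective {suc zero} {zero}     eq = ⊥-elim (Adj⇒≢ e (sym eq))
    endpoint-injective {suc zero} {suc zero} _  = refl

  edgePath-interior : ∀ {u v} (e : Adj H u v) x → ¬ Interior (edgePath e) x
  edgePath-interior e zero       (x≢0 , _) = x≢0 refl
  edgePath-interior e (suc zero) (_ , x≢1) = x≢1 refl

  reverse : Path H → Path H
  reverse P = record
    { len  = len P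
    ; vert = vert P ∘ opposite
    ; inj  = opposite-injective ∘ Path.inj P
    ; step = λ i → subst (λ k → Adj H (vert P k) (vert P (inject₁ (opposite i))))
                         (sym (opposite-inject₁ i)) (Adj-sym (Path.step P (opposite i)))
    }

  reverse-last : ∀ P → last (reverse P) ≡ first P
  reverse-last P = cong (vert P) (opposite-fromℕ (len P))

  reverse-interior : ∀ P {x} → Interior (reverse P) x → Interior P (opposite x)
  reverse-interior P {x} (x≢0 , x≢last) =
      (λ e → x≢last (opposite-injective (trans e (sym (opposite-fromℕ (len P))))))
    , (λ e → x≢0 (opposite-injective e))

module _ {n : ℕ} (G : FinGraph n) where

  copy : Bool → Fin n → Fin n ⊎ Fin n
  copy false = inj₁
  copy true  = inj₂

  copy-injective : ∀ s t {u v} → copy s u ≡ copy t v → s ≡ t × u ≡ v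
  copy-injective false false refl = refl , refl
  copy-injective true  true  refl = refl , refl
  copy-injective false true  ()
  copy-injective true  false ()

  shadow-adj : ∀ s {u v} → Adj G u v → Adj (GreatShadow G) (copy s u) (copy (not s) v)
  shadow-adj false {u} e = trans (cong (eqF u _ ∨_) e) (∨-zeroʳ (eqF u _))
  shadow-adj true  {u} e = trans (cong (eqF u _ ∨_) e) (∨-zeroʳ (eqF u _))

  shadow-rung : ∀ u → Adj (GreatShadow G) (inj₁ u) (inj₂ u)
  shadow-rung u = cong (_∨ adj G u u) (cong ⌊_⌋ (≡-≟-identity _≟_ {u} refl))

module OddCycleShadow {n : ℕ} (G : FinGraph n) (r : ℕ)
  (v : Fin (3 + r) → Fin n)
  (v-injective : Injective _≡_ _≡_ v)
  (step : ∀ (i : Fin (2 + r)) → Adj G (v (inject₁ i)) (v (suc i)))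
  (close : Adj G (v (fromℕ (2 + r))) (v zero))
  (odd : (3 + r) % 2 ≡ 1)
  where

  S : Graph (Fin n ⊎ Fin n)
  S = GreatShadow G

  branchPosition : Fin 3 → Fin (3 + r)
  branchPosition zero             = suc zero
  branchPosition (suc zero)       = zero
  branchPosition (suc (suc zero)) = fromℕ (2 + r)

  branchPosition-injective : Injective _≡_ _≡_ branchPosition
  branchPosition-injective {zero}             {zero}             _ = refl
  branchPosition-injective {suc zero}         {suc zero}         _ = refl
  branchPosition-injective {suc (suc zero)}   {suc (suc zero)}   _ = refl
  branchPosition-injective {zero}             {suc zero}         ()
  branchPosition-injective {zero}             {suc (suc zero)}   ()
  branchPosition-injective {suc zero}         {zero}             ()
  branchPosition-injective {suc zero}         {suc (suc zero)}   ()
  branchPosition-injective {suc (suc zero)}   {zero}             ()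
  branchPosition-injective {suc (suc zero)}   {suc zero}         ()

  a b : Fin 3 → Fin n ⊎ Fin n
  a i = copy G false (v (branchPosition i))
  b j = copy G true  (v (branchPosition j))

  branch-injective : Injective _≡_ _≡_ [ a , b ]
  branch-injective {inj₁ i} {inj₁ j} e = cong inj₁ (branchPosition-injective (v-injective (inj₁-injective e)))
  branch-injective {inj₂ i} {inj₂ j} e = cong inj₂ (branchPosition-injective (v-injective (inj₂-injective e)))
  branch-injective {inj₁ i} {inj₂ j} ()
  branch-injective {inj₂ i} {inj₁ j} ()

  rail : Bool → Fin (2 + r) → Fin n ⊎ Fin n
  rail s y = copy G (alternate s (toℕ y)) (v (suc y))

  rail-step : ∀ s (i : Fin (1 + r)) → Adj S (rail s (inject₁ i)) (rail s (suc i))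
  rail-step s i =
    subst (λ k → Adj S (copy G (alternate s k) (v (suc (inject₁ i)))) (rail s (suc i)))
          (sym (toℕ-inject₁ i)) (shadow-adj G (alternate s (toℕ i)) (step (suc i)))

  rail-injective : ∀ s → Injective _≡_ _≡_ (rail s)
  rail-injective s e = suc-injective (v-injective (proj₂ (copy-injective G _ _ e)))

  railPath : Bool → Path S
  railPath s = record { len = 1 + r ; vert = rail s ; inj = rail-injective s ; step = rail-step s }

  -- The arc v₁ … vₘ has 1 + r edges, and odd : (3 + r) % 2 ≡ 1 is definitionally (1 + r) % 2 ≡ 1.
  rail-last : ∀ s → rail s (fromℕ (1 + r)) ≡ copy G (not s) (v (fromℕ (2 + r)))
  rail-last s = cong (λ t → copy G t (v (fromℕ (2 + r))))
    (trans (cong (alternate s) (toℕ-fromℕ (1 + r))) (alternate-odd s (1 + r) odd))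

  rails-disjoint : ∀ s y y' → rail s y ≢ rail (not s) y'
  rails-disjoint s y y' e with copy-injective G _ _ e
  ... | same-side , same-vertex with suc-injective (v-injective same-vertex)
  ... | refl = not-¬ refl (trans same-side (alternate-not s (toℕ y)))

  rail-avoids-branchPosition : ∀ s y → Interior (railPath s) y → ∀ t k → rail s y ≢ copy G t (v (branchPosition k))
  rail-avoids-branchPosition s y (y≢0 , y≢last) t k e = off-branchPosition k (v-injective (proj₂ (copy-injective G _ t e)))
    where
    off-branchPosition : ∀ k → suc y ≢ branchPosition k
    off-branchPosition zero             e = y≢0 (suc-injective e)
    off-branchPosition (suc zero)       ()
    off-branchPosition (suc (suc zero)) e = y≢last (suc-injective e)

  rail-avoids-branch : ∀ s y → Interior (railPath s) y → ∀ w → rail s y ≢ [ a , b ] w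
  rail-avoids-branch s y y° (inj₁ i) = rail-avoids-branchPosition s y y° false i
  rail-avoids-branch s y y° (inj₂ j) = rail-avoids-branchPosition s y y° true j

  rail-avoids-edge : ∀ s y → Interior (railPath s) y →
                     ∀ {i j} (e : Adj S (a i) (b j)) z → rail s y ≢ vert (edgePath S {a i} {b j} e) z
  rail-avoids-edge s y y° {i} {j} e zero       = rail-avoids-branch s y y° (inj₁ i)
  rail-avoids-edge s y y° {i} {j} e (suc zero) = rail-avoids-branch s y y° (inj₂ j)

  data Route : Fin 3 → Fin 3 → Set where
    edge      : ∀ {i j} → Adj S (a i) (b j) → Route i j
    rail-0→2  : Route zero (suc (suc zero))
    rail-2→0  : Route (suc (suc zero)) zero

  route : ∀ i j → Route i j
  route zero             zero             = edge (shadow-rung G _)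
  route zero             (suc zero)       = edge (shadow-adj G false (Adj-sym G (step zero)))
  route zero             (suc (suc zero)) = rail-0→2
  route (suc zero)       zero             = edge (shadow-adj G false (step zero))
  route (suc zero)       (suc zero)       = edge (shadow-rung G _)
  route (suc zero)       (suc (suc zero)) = edge (shadow-adj G false (Adj-sym G close))
  route (suc (suc zero)) zero             = rail-2→0
  route (suc (suc zero)) (suc zero)       = edge (shadow-adj G false close)
  route (suc (suc zero)) (suc (suc zero)) = edge (shadow-rung G _)

  routePath : ∀ {i j} → Route i j → Path S
  routePath (edge {i} {j} e) = edgePath S {a i} {b j} e
  routePath rail-0→2 = railPath false
  routePath rail-2→0 = reverse S (railPath true)

  route-starts : ∀ {i j} (ρ : Route i j) → first (routePath ρ) ≡ a i
  route-starts (edge e) = refl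
  route-starts rail-0→2 = refl
  route-starts rail-2→0 = rail-last true

  route-ends : ∀ {i j} (ρ : Route i j) → last (routePath ρ) ≡ b j
  route-ends (edge e) = refl
  route-ends rail-0→2 = rail-last false
  route-ends rail-2→0 = reverse-last S (railPath true)

  route-interior-avoids-branch : ∀ {i j} (ρ : Route i j) x → Interior (routePath ρ) x →
                                  ∀ w → vert (routePath ρ) x ≢ [ a , b ] w
  route-interior-avoids-branch (edge {i} {j} e) x x° = ⊥-elim (edgePath-interior S {a i} {b j} e x x°)
  route-interior-avoids-branch rail-0→2 x x° = rail-avoids-branch false x x°
  route-interior-avoids-branch rail-2→0 x x° =
    rail-avoids-branch true (opposite x) (reverse-interior S (railPath true) x°)

  routes-internally-disjoint : ∀ {i j i' j'} (ρ : Route i j) (σ : Route i' j') → ¬ (i ≡ i' × j ≡ j') →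
                               ∀ x → Interior (routePath ρ) x →
                               ∀ y → vert (routePath ρ) x ≢ vert (routePath σ) y
  routes-internally-disjoint (edge {i} {j} e) _ _ x x° = ⊥-elim (edgePath-interior S {a i} {b j} e x x°)
  routes-internally-disjoint rail-0→2 (edge {i} {j} e) _ x x° = rail-avoids-edge false x x° {i} {j} e
  routes-internally-disjoint rail-0→2 rail-0→2 ≢ = ⊥-elim (≢ (refl , refl))
  routes-internally-disjoint rail-0→2 rail-2→0 _ x _ y = rails-disjoint false x (opposite y)
  routes-internally-disjoint rail-2→0 (edge {i} {j} e) _ x x° =
    rail-avoids-edge true (opposite x) (reverse-interior S (railPath true) x°) {i} {j} e
  routes-internally-disjoint rail-2→0 rail-0→2 _ x _ y = rails-disjoint true (opposite x) y
  routes-internally-disjoint rail-2→0 rail-2→0 ≢ = ⊥-elim (≢ (refl , refl))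

  shadowK33 : K33Subdivision S
  shadowK33 = record
    { a = a
    ; b = b
    ; branch-inj = branch-injective
    ; path = λ i j → routePath (route i j)
    ; starts = λ i j → route-starts (route i j)
    ; ends = λ i j → route-ends (route i j)
    ; interior-avoids-branch = λ i j → route-interior-avoids-branch (route i j)
    ; internally-disjoint = λ i j i' j' → routes-internally-disjoint (route i j) (route i' j')
    }

lemma5 : (n : ℕ) (G : FinGraph n) → OddCycle G → K33Subdivision (GreatShadow G)
lemma5 n G record { m = zero ; long = s≤s () }
lemma5 n G record { m = suc zero ; long = s≤s (s≤s ()) }
lemma5 n G record { m = suc (suc r) ; vert = v ; inj = v-injective ; odd = odd ; step = step ; close = close } =
  OddCycleShadow.shadowK33 G r v v-injective step close odd
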